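{- For every integer $t\ge 1$ and every $n$, \[ \chi(H_{2t}(n)) \le (t+1)\cdot \max_{k} \chi(L_k), \] where the maximum is over $k\in\{0,1,\dots,n\}$.
   Context: $H_{2t}(n)$ is the graph with vertex set $\{0,1\}^n$ in which $x,y$ are adjacent iff their Hamming distance is exactly $2t$. $L_k$ denotes the subgraph of $H_{2t}(n)$ induced on the set of vectors with exactly $k$ ones. $\chi$ denotes the chromatic number. -}

module Defs where

open import Data.Nat using (ℕ; zero; suc; _+_; _*_; _≤_; _<_; _⊔_)
open import Data.Bool using (Bool; true; false)
open import Data.Vec using (Vec; []; _∷_)
open import Data.Fin using (Fin; toℕ)
open import Data.Product using (Σ; _×_)
open import Relation.Binary.PropositionalEquality using (_≡_; _≢_)
open import Relation.Nullary using (¬_)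

hamming : ∀ {n} → Vec Bool n → Vec Bool n → ℕ
hamming [] [] = 0
hamming (x ∷ xs) (y ∷ ys) with x Data.Bool.≟ y
... | Relation.Nullary.yes _ = hamming xs ys
... | Relation.Nullary.no  _ = suc (hamming xs ys)

weight : ∀ {n} → Vec Bool n → ℕ
weight [] = 0
weight (true ∷ xs) = suc (weight xs)
weight (false ∷ xs) = weight xs

record Graph : Set₁ where
  field
    V   : Set
    Adj : V → V → Set

open Graph public

Colorable : Graph → ℕ → Set
Colorable G c = Σ (V G → Fin c) λ f → ∀ x y → Adj G x y → f x ≢ f y

IsChromaticNumber : Graph → ℕ → Set
IsChromaticNumber G k = Colorable G k × (∀ m → m < k → ¬ Colorable G m)

H : ℕ → ℕ → Graph
H t n = record { V = Vec Bool n ; Adj = λ x y → hamming x y ≡ 2 * t }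

L : ℕ → ℕ → ℕ → Graph
L t n k = record { V = Σ (Vec Bool n) (λ x → weight x ≡ k)
                 ; Adj = λ x y → hamming (Data.Product.proj₁ x) (Data.Product.proj₁ y) ≡ 2 * t }

maxUpTo : ℕ → (ℕ → ℕ) → ℕ
maxUpTo zero f = f 0
maxUpTo (suc n) f = maxUpTo n f ⊔ f (suc n)

-- Colour x by the pair (⌊w/2⌋ mod (t+1), colour of x in its layer L_w), where w is the weight of x.
-- If x and y are at distance 2t, with p ones only in x and q ones only in y, then p + q = 2t, so
-- their weights differ by an even number 2j with j ≤ t.  For j = 0 they lie in the same layer and
-- the layer colouring separates them; for 1 ≤ j ≤ t the halved weights differ by j, which is
-- nonzero modulo t + 1.
module Submission where

open import Defs
open import Data.Nat using (ℕ; _≤_; _*_; _+_; _≥_)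
open import Data.Nat.Base using (zero; suc; _<_; _∸_; NonZero; >-nonZero; z≤n; s≤s)
open import Data.Nat.Properties
open import Data.Nat.DivMod using (_/_; _%_; _mod_; m≡m%n+[m/n]*n; m%n<n; m*n/n≡m; +-distrib-/-∣ʳ)
open import Data.Nat.Divisibility using (_∣_; divides; divides-refl; n∣m*n; ∣m+n∣m⇒∣n; ∣⇒≤)
open import Data.Nat.Tactic.RingSolver using (solve-∀)
open import Data.Bool using (Bool; true; false)
open import Data.Vec using (Vec; []; _∷_)
open import Data.Fin using (Fin; toℕ; combine; inject≤)
open import Data.Fin.Properties using (toℕ-fromℕ<; combine-injective; inject≤-injective)
open import Data.Product using (_×_; _,_; proj₁; proj₂; ∃-syntax)
open import Data.Sum using (_⊎_; inj₁; inj₂)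
open import Data.Empty using (⊥-elim)
open import Relation.Binary.PropositionalEquality

χ≤-colorable : ∀ {G h k} → IsChromaticNumber G h → Colorable G k → h ≤ k
χ≤-colorable (_ , minimal) colouring = ≮⇒≥ λ k<h → minimal _ k<h colouring

colorable-mono : ∀ {G a b} → a ≤ b → Colorable G a → Colorable G b
colorable-mono a≤b (f , proper) =
  (λ x → inject≤ (f x) a≤b) ,
  λ x y adj eq → proper x y adj (inject≤-injective a≤b a≤b (f x) (f y) eq)

colorable-* : ∀ {G a b} (φ : V G → Fin a) (ψ : V G → Fin b) →
              (∀ x y → Adj G x y → φ x ≡ φ y → ψ x ≢ ψ y) →
              Colorable G (a * b)
colorable-* φ ψ separated =
  (λ x → combine (φ x) (ψ x)) ,
  λ x y adj eq → let φx≡φy , ψx≡ψy = combine-injective (φ x) (ψ x) (φ y) (ψ y) eq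
                 in separated x y adj φx≡φy ψx≡ψy

≤-maxUpTo : ∀ (f : ℕ → ℕ) {n k} → k ≤ n → f k ≤ maxUpTo n f
≤-maxUpTo f {zero}  z≤n = ≤-refl
≤-maxUpTo f {suc n} k≤1+n with m≤n⇒m<n∨m≡n k≤1+n
... | inj₁ (s≤s k≤n) = ≤-trans (≤-maxUpTo f k≤n) (m≤m⊔n _ _)
... | inj₂ refl      = m≤n⊔m (maxUpTo n f) (f (suc n))

m%n≢[m+o]%n : ∀ m {n o} .{{_ : NonZero n}} → 0 < o → o < n → m % n ≢ (m + o) % n
m%n≢[m+o]%n m {n} {o} 0<o o<n eq = <⇒≱ o<n (∣⇒≤ {{>-nonZero 0<o}} n∣o)
  where
  n∣o : n ∣ o
  n∣o = ∣m+n∣m⇒∣n (divides ((m + o) / n) (+-cancelˡ-≡ (m % n) _ _ (begin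
    m % n + (m / n * n + o) ≡⟨ +-assoc (m % n) _ o ⟨
    m % n + m / n * n + o   ≡⟨ cong (_+ o) (m≡m%n+[m/n]*n m n) ⟨
    m + o                   ≡⟨ m≡m%n+[m/n]*n (m + o) n ⟩
    (m + o) % n + (m + o) / n * n ≡⟨ cong (_+ (m + o) / n * n) eq ⟨
    m % n + (m + o) / n * n ∎))) (n∣m*n (m / n))
    where open ≡-Reasoning

[m+n*2]/2≡m/2+n : ∀ m n → (m + n * 2) / 2 ≡ m / 2 + n
[m+n*2]/2≡m/2+n m n = trans (+-distrib-/-∣ʳ m (divides-refl n)) (cong (m / 2 +_) (m*n/n≡m n 2))

even-split : ∀ {p q t} → p + q ≡ 2 * t → p ≤ q → ∃[ j ] j ≤ t × q ≡ p + j * 2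
even-split {p} {q} {t} p+q≡2t p≤q = t ∸ p , m∸n≤m t p , +-cancelˡ-≡ p _ _ (begin-equality
    p + q                   ≡⟨ p+q≡2t ⟩
    2 * t                   ≡⟨ cong (2 *_) (m+[n∸m]≡n p≤t) ⟨
    2 * (p + (t ∸ p))       ≡⟨ double p (t ∸ p) ⟩
    p + (p + (t ∸ p) * 2)   ∎)
  where
  open ≤-Reasoning
  double : ∀ a b → 2 * (a + b) ≡ a + (a + b * 2)
  double = solve-∀
  p≤t : p ≤ t
  p≤t = *-cancelˡ-≤ 2 (begin
    2 * p   ≡⟨ cong (p +_) (+-identityʳ p) ⟩
    p + p   ≤⟨ +-monoʳ-≤ p p≤q ⟩
    p + q   ≡⟨ p+q≡2t ⟩
    2 * t   ∎)

weight≤length : ∀ {n} (x : Vec Bool n) → weight x ≤ n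
weight≤length []           = z≤n
weight≤length (true ∷ x)  = s≤s (weight≤length x)
weight≤length (false ∷ x) = m≤n⇒m≤1+n (weight≤length x)

-- r, p and q count the positions where (x, y) is (true, true), (true, false) and (false, true)
weight-hamming-decomposition : ∀ {n} (x y : Vec Bool n) → ∃[ r ] ∃[ p ] ∃[ q ]
  weight x ≡ r + p × weight y ≡ r + q × hamming x y ≡ p + q
weight-hamming-decomposition [] [] = 0 , 0 , 0 , refl , refl , refl
weight-hamming-decomposition (true ∷ x) (true ∷ y) =
  let r , p , q , wx , wy , d = weight-hamming-decomposition x y
  in suc r , p , q , cong suc wx , cong suc wy , d
weight-hamming-decomposition (true ∷ x) (false ∷ y) =
  let r , p , q , wx , wy , d = weight-hamming-decomposition x y
  in r , suc p , q , trans (cong suc wx) (sym (+-suc r p)) , wy , cong suc d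
weight-hamming-decomposition (false ∷ x) (true ∷ y) =
  let r , p , q , wx , wy , d = weight-hamming-decomposition x y
  in r , p , suc q , wx , trans (cong suc wy) (sym (+-suc r q)) , trans (cong suc d) (sym (+-suc p q))
weight-hamming-decomposition (false ∷ x) (false ∷ y) = weight-hamming-decomposition x y

common-part-gap : ∀ {a b r p q k} → a ≡ r + p → b ≡ r + q → q ≡ p + k → b ≡ a + k
common-part-gap {r = r} {p} {k = k} refl refl refl = sym (+-assoc r p k)

adjacent-weight-gap : ∀ {t n} {x y : Vec Bool n} → hamming x y ≡ 2 * t →
  ∃[ j ] j ≤ t × (weight y ≡ weight x + j * 2 ⊎ weight x ≡ weight y + j * 2)
adjacent-weight-gap {x = x} {y} adj with weight-hamming-decomposition x y
... | r , p , q , wx , wy , d with ≤-total p q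
...   | inj₁ p≤q = let j , j≤t , q≡p+2j = even-split (trans (sym d) adj) p≤q
                   in j , j≤t , inj₁ (common-part-gap wx wy q≡p+2j)
...   | inj₂ q≤p = let j , j≤t , p≡q+2j = even-split (trans (+-comm q p) (trans (sym d) adj)) q≤p
                   in j , j≤t , inj₂ (common-part-gap wy wx p≡q+2j)

module _ {t n M : ℕ} (layer : ∀ k → k ≤ n → Colorable (L t n k) M) where

  layerColour : Vec Bool n → Fin M
  layerColour x = proj₁ (layer (weight x) (weight≤length x)) (x , refl)

  layerColour-proper : ∀ x y → weight x ≡ weight y → Adj (H t n) x y →
                       layerColour x ≢ layerColour y
  layerColour-proper x y wx≡wy = proper-at (weight≤length x) (weight≤length y) refl refl wx≡wy
    where
    proper-at : ∀ {k k′} (k≤n : k ≤ n) (k′≤n : k′ ≤ n) (wx≡k : weight x ≡ k) (wy≡k′ : weight y ≡ k′) →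
                k ≡ k′ → Adj (H t n) x y →
                proj₁ (layer k k≤n) (x , wx≡k) ≢ proj₁ (layer k′ k′≤n) (y , wy≡k′)
    proper-at k≤n k′≤n wx≡k wy≡k′ refl rewrite ≤-irrelevant k≤n k′≤n =
      proj₂ (layer _ k′≤n) (x , wx≡k) (y , wy≡k′)

  weightClass : Vec Bool n → Fin (suc t)
  weightClass x = (weight x / 2) mod suc t

  weightClass-distinct : ∀ x y {j} → weight y ≡ weight x + suc j * 2 → suc j ≤ t →
                         weightClass x ≢ weightClass y
  weightClass-distinct x y {j} wy≡ j<t eq = m%n≢[m+o]%n (weight x / 2) (s≤s z≤n) (s≤s j<t) (begin
    weight x / 2 % suc t                     ≡⟨ toℕ-fromℕ< (m%n<n (weight x / 2) (suc t)) ⟨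
    toℕ (weightClass x)                      ≡⟨ cong toℕ eq ⟩
    toℕ (weightClass y)                      ≡⟨ toℕ-fromℕ< (m%n<n (weight y / 2) (suc t)) ⟩
    weight y / 2 % suc t                     ≡⟨ cong (λ w → w / 2 % suc t) wy≡ ⟩
    (weight x + suc j * 2) / 2 % suc t       ≡⟨ cong (_% suc t) ([m+n*2]/2≡m/2+n (weight x) (suc j)) ⟩
    (weight x / 2 + suc j) % suc t           ∎)
    where open ≡-Reasoning

  H-colorable : Colorable (H t n) (suc t * M)
  H-colorable = colorable-* weightClass layerColour separated
    where
    separated : ∀ x y → Adj (H t n) x y → weightClass x ≡ weightClass y → layerColour x ≢ layerColour y
    separated x y adj same-class with adjacent-weight-gap {x = x} {y} adj
    ... | zero  , _   , inj₁ wy≡wx+0 = layerColour-proper x y (sym (trans wy≡wx+0 (+-identityʳ _))) adj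
    ... | zero  , _   , inj₂ wx≡wy+0 = layerColour-proper x y (trans wx≡wy+0 (+-identityʳ _)) adj
    ... | suc j , j<t , inj₁ wy≡ = ⊥-elim (weightClass-distinct x y wy≡ j<t same-class)
    ... | suc j , j<t , inj₂ wx≡ = ⊥-elim (weightClass-distinct y x wx≡ j<t (sym same-class))

lemma3p2 : (t n : ℕ) → t ≥ 1 →
    (h : ℕ) → IsChromaticNumber (H t n) h →
    (c : ℕ → ℕ) → (∀ k → k ≤ n → IsChromaticNumber (L t n k) (c k)) →
    h ≤ (t + 1) * maxUpTo n c
lemma3p2 t n _ h χH c χL =
  subst (λ m → h ≤ m * maxUpTo n c) (+-comm 1 t) (χ≤-colorable χH (H-colorable {t} layer))
  where
  layer : ∀ k → k ≤ n → Colorable (L t n k) (maxUpTo n c)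
  layer k k≤n = colorable-mono (≤-maxUpTo c k≤n) (proj₁ (χL k k≤n))
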